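{- Let $a\ge1$ and $b\ge0$ be integers with $b<a$. Then every animal is an $(a,b)$-winner.
   Context: A board is one of the regular tilings (square, triangular or hexagonal tiling of the plane, or the cubic tiling of space); its tiles are cells, adjacent if they share an edge (face for cubes). An animal is a finite connected set of cells up to congruence. In the weak $(a,b)$ achievement game for goal animal $A$ on the infinite board, maker and breaker alternately mark previously unmarked cells, maker first, the maker marking $a$ and the breaker $b$ cells per turn; the maker wins if his marked cells at some point contain a set congruent to $A$. $A$ is an $(a,b)$-winner if the maker has a strategy guaranteeing a win in finitely many turns against every breaker play. -}

module Defs where

open import Data.Nat using (ℕ)
open import Data.Integer using (ℤ; _+_; +_; -[1+_])
open import Data.Bool using (Bool; true; false)
open import Data.List using (List; []; _∷_; _++_; length; map)
open import Data.List.Relation.Unary.All using (All)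
open import Data.List.Relation.Unary.Any using (Any)
open import Data.List.Membership.Propositional using (_∈_)
open import Data.List.Relation.Unary.Unique.Propositional using (Unique)
open import Data.Product using (Σ; _×_; _,_; ∃)
open import Data.Sum using (_⊎_)
open import Relation.Nullary using (¬_)
open import Relation.Binary.PropositionalEquality using (_≡_)

-- Boards: a set of cells together with the adjacency relation
-- (sharing an edge, resp. a face for cubes).

record Board : Set₁ where
  field
    Cell : Set
    Adj  : Cell → Cell → Set
open Board public

z0 z1 m1 : ℤ
z0 = + 0
z1 = + 1
m1 = -[1+ 0 ]

-- Square tiling: unit squares indexed by ℤ².
-- Hexagonal tiling: hexagons in axial coordinates (ℤ²), six neighbours.
-- Both adjacencies: the difference of the cells is one of the given offsets.
Offsets2 : Set
Offsets2 = List (ℤ × ℤ)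

squareOffsets : Offsets2
squareOffsets = (z1 , z0) ∷ (m1 , z0) ∷ (z0 , z1) ∷ (z0 , m1) ∷ []

hexOffsets : Offsets2
hexOffsets = (z1 , z0) ∷ (m1 , z0) ∷ (z0 , z1) ∷ (z0 , m1) ∷ (z1 , m1) ∷ (m1 , z1) ∷ []

Adj2 : Offsets2 → ℤ × ℤ → ℤ × ℤ → Set
Adj2 offs (x , y) (x' , y') = Any (λ { (dx , dy) → (x' ≡ x + dx) × (y' ≡ y + dy) }) offs

squareBoard : Board
squareBoard = record { Cell = ℤ × ℤ ; Adj = Adj2 squareOffsets }

hexBoard : Board
hexBoard = record { Cell = ℤ × ℤ ; Adj = Adj2 hexOffsets }

cubeOffsets : List (ℤ × ℤ × ℤ)
cubeOffsets = (z1 , z0 , z0) ∷ (m1 , z0 , z0) ∷ (z0 , z1 , z0) ∷ (z0 , m1 , z0)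
            ∷ (z0 , z0 , z1) ∷ (z0 , z0 , m1) ∷ []

Adj3 : ℤ × ℤ × ℤ → ℤ × ℤ × ℤ → Set
Adj3 (x , y , z) (x' , y' , z') =
  Any (λ { (dx , dy , dz) → (x' ≡ x + dx) × (y' ≡ y + dy) × (z' ≡ z + dz) }) cubeOffsets

cubicBoard : Board
cubicBoard = record { Cell = ℤ × ℤ × ℤ ; Adj = Adj3 }

-- Triangular tiling: lattice points (x , y) in a triangular lattice basis;
-- the rhombus with corner (x , y) splits into an "up" triangle (true) with
-- vertices (x,y),(x+1,y),(x,y+1) and a "down" triangle (false) with vertices
-- (x+1,y),(x,y+1),(x+1,y+1).  The up triangle (x , y) shares its three edges
-- with the down triangles (x , y), (x-1 , y), (x , y-1).
triUpDownOffsets : Offsets2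
triUpDownOffsets = (z0 , z0) ∷ (m1 , z0) ∷ (z0 , m1) ∷ []

TriAdjUD : ℤ × ℤ × Bool → ℤ × ℤ × Bool → Set
TriAdjUD (x , y , true)  (x' , y' , false) = Adj2 triUpDownOffsets (x , y) (x' , y')
TriAdjUD _ _ = Data.Empty.⊥
  where import Data.Empty

TriAdj : ℤ × ℤ × Bool → ℤ × ℤ × Bool → Set
TriAdj c d = TriAdjUD c d ⊎ TriAdjUD d c

triBoard : Board
triBoard = record { Cell = ℤ × ℤ × Bool ; Adj = TriAdj }

data BoardName : Set where
  square triangular hexagonal cubic : BoardName

board : BoardName → Board
board square     = squareBoard
board triangular = triBoard
board hexagonal  = hexBoard
board cubic      = cubicBoard

module _ (B : Board) where
  private
    C = Cell B
    _~_ = Adj B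

  -- Congruences (symmetries) of the board: bijections of the cells
  -- preserving and reflecting adjacency (for the four regular tilings these
  -- are exactly the isometries of the tiling).
  record Congruence : Set where
    field
      to       : C → C
      from     : C → C
      to-from  : ∀ c → to (from c) ≡ c
      from-to  : ∀ c → from (to c) ≡ c
      adj-pres : ∀ c d → c ~ d → to c ~ to d
      adj-refl : ∀ c d → to c ~ to d → c ~ d

  data Reach (S : List C) : C → C → Set where
    here  : ∀ {c} → Reach S c c
    there : ∀ {c d e} → c ~ d → d ∈ S → Reach S d e → Reach S c e

  Connected : List C → Set
  Connected S = ∀ {c d} → c ∈ S → d ∈ S → Reach S c d

  ContainsCopy : List C → List C → Set
  ContainsCopy A M = Σ Congruence λ φ → All (λ c → Congruence.to φ c ∈ M) A

  LegalTurn : ℕ → List C → List C → Set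
  LegalTurn k marked m = (length m ≡ k) × Unique m × All (λ c → ¬ (c ∈ marked)) m

  -- MakerWins a b A M Br : from the position where the maker has marked M and
  -- the breaker Br, with the maker to move, the maker can force a win in
  -- finitely many turns (well-founded game tree).
  data MakerWins (a b : ℕ) (A : List C) : List C → List C → Set where
    move : ∀ {M Br} (m : List C) → LegalTurn a (M ++ Br) m →
           ( ContainsCopy A (m ++ M)
           ⊎ (∀ r → LegalTurn b (m ++ M ++ Br) r → MakerWins a b A (m ++ M) (r ++ Br)) ) →
           MakerWins a b A M Br

  Winner : ℕ → ℕ → List C → Set
  Winner a b A = MakerWins a b A [] []

module Submission where

-- Since b < a, the maker can build A on many pairwise disjoint congruent copies ("boxes").
-- A box has level s when all but s of its cells are the maker's and the other s are unmarked.
-- From k(a+b) boxes of level s+1 the maker obtains k boxes of level s in k rounds: each round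
-- he fills one more cell in a of them, and the breaker's b cells, each lying in at most one box,
-- destroy at most b boxes of either level, so the finished boxes gain at least a - b ≥ 1 per
-- round while the pool loses at most a + b.  Starting from (a+b)^|A| empty boxes, translated far
-- away from everything marked, a complete copy of A appears after |A| stages.

open import Defs
open import Data.Nat using (ℕ; _≤_; _<_)
open import Data.List using (List)

open import Data.Nat using (zero; suc; _+_; _*_; z≤n; s≤s)
import Data.Nat.Properties as ℕ
open import Data.Nat.ListAction using (sum)
open import Data.Integer as ℤ using (ℤ; +_; -_; ∣_∣)
import Data.Integer.Properties as ℤₚ
open import Algebra.Properties.AbelianGroup ℤₚ.+-0-abelianGroup
  using (\\-leftDividesˡ; \\-leftDividesʳ; //-rightDividesʳ)
open import Data.Bool using (Bool; true; false)
import Data.Bool.Properties as Boolₚ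
open import Data.Product using (Σ; _×_; _,_; proj₁; proj₂; ∃₂)
open import Data.Product.Properties using (≡-dec)
open import Data.Sum using (_⊎_; inj₁; inj₂; [_,_]′)
open import Data.List using ([]; _∷_; _++_; length; map; filter; deduplicate)
import Data.List.Properties as Listₚ
open import Data.List.Relation.Unary.All as All using (All; []; _∷_)
import Data.List.Relation.Unary.All.Properties as Allₚ
open import Data.List.Relation.Unary.Any as Any using (here; there)
open import Data.List.Relation.Unary.AllPairs as AllPairs using (AllPairs; []; _∷_)
import Data.List.Relation.Unary.AllPairs.Properties as AllPairsₚ
open import Data.List.Membership.Propositional using (_∈_; _∉_)
open import Data.List.Membership.Propositional.Properties
  using (∈-map⁺; ∈-map⁻; ∈-++⁺ˡ; ∈-++⁺ʳ; ∈-++⁻)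
open import Data.List.Relation.Unary.Unique.Propositional using (Unique)
import Data.List.Relation.Unary.Unique.Propositional.Properties as Uniqueₚ
open import Data.Vec as Vec using (Vec)
import Data.Vec.Properties as Vecₚ
open import Relation.Nullary using (Dec; ¬?; yes; no)
open import Level using (0ℓ)
open import Relation.Binary using (Rel; Symmetric)
open import Relation.Binary.Definitions using (DecidableEquality)
open import Relation.Binary.PropositionalEquality

∉-++ : ∀ {A : Set} {x : A} xs {ys} → x ∉ xs → x ∉ ys → x ∉ xs ++ ys
∉-++ xs x∉xs x∉ys x∈ = [ x∉xs , x∉ys ]′ (∈-++⁻ xs x∈)

AllPairs-++⁻ : ∀ {A : Set} {R : Rel A 0ℓ} xs {ys} → AllPairs R (xs ++ ys) →
               AllPairs R xs × AllPairs R ys × All (λ x → All (R x) ys) xs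
AllPairs-++⁻ []       pairs = [] , pairs , []
AllPairs-++⁻ (x ∷ xs) (x~ ∷ pairs) with AllPairs-++⁻ xs pairs
... | xs-pairs , ys-pairs , xs~ys =
  Allₚ.++⁻ˡ xs x~ ∷ xs-pairs , ys-pairs , Allₚ.++⁻ʳ xs x~ ∷ xs~ys

AllPairs-∈ : ∀ {A : Set} {R : Rel A 0ℓ} {xs x y} → Symmetric R → AllPairs R xs →
             x ∈ xs → y ∈ xs → x ≡ y ⊎ R x y
AllPairs-∈ sym (_  ∷ _)     (here refl) (here refl) = inj₁ refl
AllPairs-∈ sym (x~ ∷ _)     (here refl) (there y∈)  = inj₂ (All.lookup x~ y∈)
AllPairs-∈ sym (y~ ∷ _)     (there x∈)  (here refl) = inj₂ (sym (All.lookup y~ x∈))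
AllPairs-∈ sym (_  ∷ pairs) (there x∈)  (there y∈)  = AllPairs-∈ sym pairs x∈ y∈

split-prefix : ∀ {A : Set} k (xs : List A) → k ≤ length xs →
               ∃₂ λ ys zs → length ys ≡ k × xs ≡ ys ++ zs
split-prefix zero    xs       _       = [] , xs , refl , refl
split-prefix (suc k) (x ∷ xs) (s≤s k≤) with split-prefix k xs k≤
... | ys , zs , refl , refl = x ∷ ys , zs , refl , refl

toList-head-tail : ∀ {A : Set} {s} (v : Vec A (suc s)) →
                   Vec.toList v ≡ Vec.head v ∷ Vec.toList (Vec.tail v)
toList-head-tail (_ Vec.∷ _) = refl

Displaceable : Board → Set
Displaceable B = ∀ (X S : List (Cell B)) →
  Σ (Congruence B) λ φ → All (λ c → Congruence.to φ c ∉ S) X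

module Forcing (B : Board) (a b : ℕ) where

  data Forces (P : List (Cell B) → List (Cell B) → Set) : List (Cell B) → List (Cell B) → Set where
    done : ∀ {M Br} → P M Br → Forces P M Br
    step : ∀ {M Br} (m : List (Cell B)) → LegalTurn B a (M ++ Br) m →
           (∀ r → LegalTurn B b (m ++ M ++ Br) r → Forces P (m ++ M) (r ++ Br)) →
           Forces P M Br

  _>>=_ : ∀ {P Q M Br} → Forces P M Br → (∀ {M Br} → P M Br → Forces Q M Br) → Forces Q M Br
  done p            >>= k = k p
  step m legal next >>= k = step m legal λ r legal′ → next r legal′ >>= k

  module _ (fresh : ∀ S → Σ (Cell B) (_∉ S)) where

    fresh-turn : ∀ k S → Σ (List (Cell B)) (LegalTurn B k S)
    fresh-turn zero    S = [] , refl , [] , []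
    fresh-turn (suc k) S with fresh S
    ... | c , c∉S with fresh-turn k (c ∷ S)
    ... | m , refl , m-unique , m∉ =
      c ∷ m , refl ,
      All.map (λ d∉ c≡d → d∉ (here (sym c≡d))) m∉ ∷ m-unique ,
      c∉S ∷ All.map (λ d∉ d∈S → d∉ (there d∈S)) m∉

    forces⇒wins : ∀ {A P M Br} → (∀ {M Br} → P M Br → ContainsCopy B A M) →
                  Forces P M Br → MakerWins B a b A M Br
    forces⇒wins {M = M} {Br} copy (done p) with fresh-turn a (M ++ Br) | copy p
    ... | m , legal | φ , A↦M = move m legal (inj₁ (φ , All.map (∈-++⁺ʳ m) A↦M))
    forces⇒wins copy (step m legal next) =
      move m legal (inj₂ λ r legal′ → forces⇒wins copy (next r legal′))

module BoxStrategy {B : Board} (_≟_ : DecidableEquality (Cell B)) (displace : Displaceable B)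
                   (c₀ : Cell B) {a b : ℕ} (b<a : b < a) (A : List (Cell B)) where

  open Congruence
  open Forcing B a b
  open import Data.List.Membership.DecPropositional _≟_ using (_∈?_)
  import Data.List.Relation.Unary.Unique.DecPropositional.Properties _≟_ as UniqueDec

  private
    C : Set
    C = Cell B

  -- Duplicates are removed so that the cells of every box are pairwise distinct.
  shape : List C
  shape = deduplicate _≟_ A

  n : ℕ
  n = length shape

  cells : Congruence B → List C
  cells φ = map (to φ) shape

  cells-unique : ∀ φ → Unique (cells φ)
  cells-unique φ = Uniqueₚ.map⁺ to-injective (UniqueDec.deduplicate-! A)
    where
    to-injective : ∀ {c d} → to φ c ≡ to φ d → c ≡ d
    to-injective {c} {d} eq = begin
      c               ≡⟨ from-to φ c ⟨
      from φ (to φ c) ≡⟨ cong (from φ) eq ⟩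
      from φ (to φ d) ≡⟨ from-to φ d ⟩
      d               ∎
      where open ≡-Reasoning

  Apart : Congruence B → Congruence B → Set
  Apart φ ψ = All (_∉ cells ψ) (cells φ)

  Apart-sym : ∀ {φ ψ} → Apart φ ψ → Apart ψ φ
  Apart-sym φ#ψ = All.tabulate λ c∈ψ c∈φ → All.lookup φ#ψ c∈φ c∈ψ

  fresh-cell : ∀ S → Σ C (_∉ S)
  fresh-cell S with displace (c₀ ∷ []) S
  ... | φ , c₀↦∉S ∷ [] = to φ c₀ , c₀↦∉S

  apart-places : ∀ k S → Σ (List (Congruence B)) λ Φ →
                 length Φ ≡ k × AllPairs Apart Φ × All (λ φ → All (_∉ S) (cells φ)) Φ
  apart-places zero    S = [] , refl , [] , []
  apart-places (suc k) S with displace shape S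
  ... | φ , φ∉S with apart-places k (S ++ cells φ)
  ... | Φ , refl , Φ-apart , Φ∉ =
    φ ∷ Φ , refl ,
    All.map (λ {ψ} ψ∉ → Apart-sym {ψ} {φ} (All.map (λ c∉ c∈φ → c∉ (∈-++⁺ʳ S c∈φ)) ψ∉)) Φ∉
      ∷ Φ-apart ,
    Allₚ.map⁺ φ∉S ∷ All.map (All.map (λ c∉ c∈S → c∉ (∈-++⁺ˡ c∈S))) Φ∉

  record Box (s : ℕ) : Set where
    field
      place  : Congruence B
      filled : List C
      free   : Vec C s
      split  : filled ++ Vec.toList free ≡ cells place
  open Box

  free⊆cells : ∀ {s c} (x : Box s) → c ∈ Vec.toList (free x) → c ∈ cells (place x)
  free⊆cells {c = c} x c∈ = subst (c ∈_) (split x) (∈-++⁺ʳ (filled x) c∈)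

  free-unique : ∀ {s} (x : Box s) → Unique (Vec.toList (free x))
  free-unique x =
    proj₁ (proj₂ (AllPairs-++⁻ (filled x) (subst Unique (sym (split x)) (cells-unique (place x)))))

  _#_ : ∀ {s t} → Box s → Box t → Set
  x # y = Apart (place x) (place y)

  #-sym : ∀ {s t} {x : Box s} {y : Box t} → x # y → y # x
  #-sym {x = x} {y} = Apart-sym {place x} {place y}

  empty-box : Congruence B → Box n
  empty-box φ = record
    { place  = φ
    ; filled = []
    ; free   = Vec.map (to φ) (Vec.fromList shape)
    ; split  = empty-split
    }
    where
    empty-split : Vec.toList (Vec.map (to φ) (Vec.fromList shape)) ≡ cells φ
    empty-split = trans (Vecₚ.toList-map (to φ) (Vec.fromList shape))
                        (cong (map (to φ)) (Vecₚ.toList∘fromList shape))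

  next : ∀ {s} → Box (suc s) → C
  next x = Vec.head (free x)

  promote : ∀ {s} → Box (suc s) → Box s
  promote x = record
    { place  = place x
    ; filled = filled x ++ next x ∷ []
    ; free   = Vec.tail (free x)
    ; split  = promote-split
    }
    where
    open ≡-Reasoning
    promote-split : (filled x ++ next x ∷ []) ++ Vec.toList (Vec.tail (free x)) ≡ cells (place x)
    promote-split = begin
      (filled x ++ next x ∷ []) ++ Vec.toList (Vec.tail (free x))
        ≡⟨ Listₚ.++-assoc (filled x) (next x ∷ []) _ ⟩
      filled x ++ next x ∷ Vec.toList (Vec.tail (free x))
        ≡⟨ cong (filled x ++_) (toList-head-tail (free x)) ⟨
      filled x ++ Vec.toList (free x)
        ≡⟨ split x ⟩
      cells (place x) ∎

  next∈free : ∀ {s} (x : Box (suc s)) → next x ∈ Vec.toList (free x)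
  next∈free x = subst (next x ∈_) (sym (toList-head-tail (free x))) (here refl)

  next∈cells : ∀ {s} (x : Box (suc s)) → next x ∈ cells (place x)
  next∈cells x = free⊆cells x (next∈free x)

  tail⊆free : ∀ {s c} (x : Box (suc s)) → c ∈ Vec.toList (Vec.tail (free x)) → c ∈ Vec.toList (free x)
  tail⊆free {c = c} x c∈ = subst (c ∈_) (sym (toList-head-tail (free x))) (there c∈)

  next∉tail : ∀ {s} (x : Box (suc s)) → next x ∉ Vec.toList (Vec.tail (free x))
  next∉tail x next∈ with subst Unique (toList-head-tail (free x)) (free-unique x)
  ... | next≢ ∷ _ = All.lookup next≢ next∈ refl

  record Alive {s} (M Br : List C) (x : Box s) : Set where
    field
      filled⊆M : All (_∈ M) (filled x)
      free∉M   : All (_∉ M) (Vec.toList (free x))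
      free∉Br  : All (_∉ Br) (Vec.toList (free x))
  open Alive

  empty-alive : ∀ {M Br φ} → All (_∉ M ++ Br) (cells φ) → Alive M Br (empty-box φ)
  empty-alive {M} {Br} {φ} φ∉ = record
    { filled⊆M = []
    ; free∉M   = free-cells (All.map (λ c∉ c∈M → c∉ (∈-++⁺ˡ c∈M)) φ∉)
    ; free∉Br  = free-cells (All.map (λ c∉ c∈Br → c∉ (∈-++⁺ʳ M c∈Br)) φ∉)
    }
    where
    free-cells : ∀ {P : C → Set} → All P (cells φ) → All P (Vec.toList (free (empty-box φ)))
    free-cells = subst (All _) (sym (split (empty-box φ)))

  record Stock (s k : ℕ) (M Br : List C) : Set where
    field
      boxes  : List (Box s)
      enough : k ≤ length boxes
      apart  : AllPairs _#_ boxes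
      alive  : All (Alive M Br) boxes

  initial-stock : ∀ k M Br → Stock n k M Br
  initial-stock k M Br with apart-places k (M ++ Br)
  ... | Φ , |Φ| , Φ-apart , Φ∉ = record
    { boxes  = map empty-box Φ
    ; enough = ℕ.≤-reflexive (sym (trans (Listₚ.length-map empty-box Φ) |Φ|))
    ; apart  = AllPairsₚ.map⁺ Φ-apart
    ; alive  = Allₚ.map⁺ (All.map empty-alive Φ∉)
    }

  stock-weaken : ∀ {s k k′ M Br} → k ≤ k′ → Stock s k′ M Br → Stock s k M Br
  stock-weaken k≤k′ st = record
    { boxes = boxes ; enough = ℕ.≤-trans k≤k′ enough ; apart = apart ; alive = alive }
    where open Stock st

  heads : ∀ {s} → List (Box (suc s)) → List C
  heads = map next

  heads-legal : ∀ {s M Br} (P : List (Box (suc s))) → length P ≡ a → AllPairs _#_ P →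
                All (Alive M Br) P → LegalTurn B a (M ++ Br) (heads P)
  heads-legal {s} {M} {Br} P |P| P-apart P-alive =
    trans (Listₚ.length-map next P) |P| ,
    AllPairsₚ.map⁺ (AllPairs.map (λ {x} {y} → heads-differ {x} {y}) P-apart) ,
    Allₚ.map⁺ (All.map next-unmarked P-alive)
    where
    next-unmarked : ∀ {x : Box (suc s)} → Alive M Br x → next x ∉ M ++ Br
    next-unmarked {x} ax =
      ∉-++ M (All.lookup (free∉M ax) (next∈free x)) (All.lookup (free∉Br ax) (next∈free x))
    heads-differ : ∀ {x y : Box (suc s)} → x # y → next x ≢ next y
    heads-differ {x} {y} x#y eq =
      All.lookup x#y (next∈cells x) (subst (_∈ cells (place y)) (sym eq) (next∈cells y))

  apart⇒∉heads : ∀ {s t c} {x : Box t} (P : List (Box (suc s))) → All (x #_) P →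
                 c ∈ cells (place x) → c ∉ heads P
  apart⇒∉heads P x#P c∈x c∈heads with ∈-map⁻ next c∈heads
  ... | p , p∈P , refl = All.lookup (All.lookup x#P p∈P) c∈x (next∈cells p)

  alive-beside-heads : ∀ {s t M Br} {x : Box t} (P : List (Box (suc s))) → All (x #_) P →
                       Alive M Br x → Alive (heads P ++ M) Br x
  alive-beside-heads {x = x} P x#P ax = record
    { filled⊆M = All.map (∈-++⁺ʳ (heads P)) (filled⊆M ax)
    ; free∉M   = All.tabulate λ c∈ →
        ∉-++ (heads P) (apart⇒∉heads {x = x} P x#P (free⊆cells x c∈)) (All.lookup (free∉M ax) c∈)
    ; free∉Br  = free∉Br ax
    }

  promote-alive : ∀ {s M Br p} {P : List (Box (suc s))} → AllPairs _#_ P → p ∈ P →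
                  Alive M Br p → Alive (heads P ++ M) Br (promote p)
  promote-alive {p = p} {P} P-apart p∈P ap = record
    { filled⊆M = Allₚ.++⁺ (All.map (∈-++⁺ʳ (heads P)) (filled⊆M ap))
                          (∈-++⁺ˡ (∈-map⁺ next p∈P) ∷ [])
    ; free∉M   = All.tabulate λ c∈ →
        ∉-++ (heads P) (tail∉heads c∈) (All.lookup (free∉M ap) (tail⊆free p c∈))
    ; free∉Br  = All.tabulate λ c∈ → All.lookup (free∉Br ap) (tail⊆free p c∈)
    }
    where
    tail∉heads : ∀ {c} → c ∈ Vec.toList (Vec.tail (free p)) → c ∉ heads P
    tail∉heads c∈ c∈heads with ∈-map⁻ next c∈heads
    ... | q , q∈P , refl with AllPairs-∈ (λ {x} {y} → #-sym {x = x} {y}) P-apart p∈P q∈P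
    ... | inj₁ refl = next∉tail p c∈
    ... | inj₂ p#q  = All.lookup p#q (free⊆cells p (tail⊆free p c∈)) (next∈cells q)

  Avoids : ∀ {s} → List C → Box s → Set
  Avoids r x = All (_∉ cells (place x)) r

  alive-avoiding : ∀ {s M Br r} {x : Box s} → Avoids r x → Alive M Br x → Alive M (r ++ Br) x
  alive-avoiding {r = r} {x} x-avoids ax = record
    { filled⊆M = filled⊆M ax
    ; free∉M   = free∉M ax
    ; free∉Br  = All.tabulate λ c∈ →
        ∉-++ r (λ c∈r → All.lookup x-avoids c∈r (free⊆cells x c∈)) (All.lookup (free∉Br ax) c∈)
    }

  module _ {s : ℕ} where

    misses? : (c : C) (x : Box s) → Dec (c ∉ cells (place x))
    misses? c x = ¬? (c ∈? cells (place x))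

    survivors : List C → List (Box s) → List (Box s)
    survivors []      X = X
    survivors (c ∷ r) X = filter (misses? c) (survivors r X)

    survivors-all : ∀ {P : Box s → Set} r {X} → All P X → All P (survivors r X)
    survivors-all []      all = all
    survivors-all (c ∷ r) all = Allₚ.filter⁺ (misses? c) (survivors-all r all)

    survivors-apart : ∀ r {X} → AllPairs _#_ X → AllPairs _#_ (survivors r X)
    survivors-apart []      X-apart = X-apart
    survivors-apart (c ∷ r) X-apart = AllPairsₚ.filter⁺ (misses? c) (survivors-apart r X-apart)

    survivors-avoid : ∀ r X → All (Avoids r) (survivors r X)
    survivors-avoid []      X = All.tabulate λ _ → []
    survivors-avoid (c ∷ r) X =
      All.zipWith (λ (c∉ , r-avoids) → c∉ ∷ r-avoids)
        (Allₚ.all-filter (misses? c) (survivors r X) ,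
         Allₚ.filter⁺ (misses? c) (survivors-avoid r X))

    survivors-alive : ∀ {M Br} r X → All (Alive M Br) X → All (Alive M (r ++ Br)) (survivors r X)
    survivors-alive r X X-alive =
      All.zipWith (λ (ax , x-avoids) → alive-avoiding x-avoids ax)
        (survivors-all r X-alive , survivors-avoid r X)

    hits-at-most-one : ∀ c X → AllPairs _#_ X → length X ≤ suc (length (filter (misses? c) X))
    hits-at-most-one c []      _                = z≤n
    hits-at-most-one c (x ∷ X) (x#X ∷ X-apart) with c ∈? cells (place x)
    ... | yes c∈x = s≤s (ℕ.≤-reflexive (cong length (sym (Listₚ.filter-all (misses? c)
                      (All.map (λ x#y → All.lookup x#y c∈x) x#X)))))
    ... | no  _   = s≤s (hits-at-most-one c X X-apart)

    survivors-length : ∀ r X → AllPairs _#_ X → length X ≤ length r + length (survivors r X)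
    survivors-length []      X _       = ℕ.≤-refl
    survivors-length (c ∷ r) X X-apart = begin
      length X
        ≤⟨ survivors-length r X X-apart ⟩
      length r + length (survivors r X)
        ≤⟨ ℕ.+-monoʳ-≤ (length r) (hits-at-most-one c _ (survivors-apart r X-apart)) ⟩
      length r + suc (length (survivors (c ∷ r) X))
        ≡⟨ ℕ.+-suc (length r) _ ⟩
      suc (length r) + length (survivors (c ∷ r) X) ∎
      where open ℕ.≤-Reasoning

  record Layout {s} (M Br : List C) (finished : List (Box s)) (pool : List (Box (suc s))) : Set where
    field
      finished-apart : AllPairs _#_ finished
      pool-apart     : AllPairs _#_ pool
      finished#pool  : All (λ x → All (x #_) pool) finished
      finished-alive : All (Alive M Br) finished
      pool-alive     : All (Alive M Br) pool
  open Layout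

  after-maker : ∀ {s M Br} {finished : List (Box s)} P R → Layout M Br finished (P ++ R) →
                Layout (heads P ++ M) Br (finished ++ map promote P) R
  after-maker {M = M} {Br} {finished} P R lay with AllPairs-++⁻ P (pool-apart lay)
  ... | P-apart , R-apart , P#R = record
    { finished-apart = AllPairsₚ.++⁺ (finished-apart lay) (AllPairsₚ.map⁺ P-apart)
                                     (All.map Allₚ.map⁺ finished#P)
    ; pool-apart     = R-apart
    ; finished#pool  = Allₚ.++⁺ (All.map (Allₚ.++⁻ʳ P) (finished#pool lay)) (Allₚ.map⁺ P#R)
    ; finished-alive = Allₚ.++⁺
        (All.zipWith (λ (x#P , ax) → alive-beside-heads P x#P ax) (finished#P , finished-alive lay))
        (Allₚ.map⁺ (All.tabulate λ p∈P → promote-alive P-apart p∈P (All.lookup P-alive p∈P)))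
    ; pool-alive     = All.zipWith (λ (x#P , ax) → alive-beside-heads P x#P ax)
        (All.tabulate (λ {x} x∈R → All.map (λ {p} p#R → #-sym {x = p} {x} (All.lookup p#R x∈R)) P#R) ,
         Allₚ.++⁻ʳ P (pool-alive lay))
    }
    where
    finished#P : All (λ x → All (x #_) P) finished
    finished#P = All.map (Allₚ.++⁻ˡ P) (finished#pool lay)
    P-alive : All (Alive M Br) P
    P-alive = Allₚ.++⁻ˡ P (pool-alive lay)

  after-breaker : ∀ {s M Br} {finished : List (Box s)} {pool : List (Box (suc s))} r →
                  Layout M Br finished pool → Layout M (r ++ Br) (survivors r finished) (survivors r pool)
  after-breaker {finished = finished} {pool} r lay = record
    { finished-apart = survivors-apart r (finished-apart lay)
    ; pool-apart     = survivors-apart r (pool-apart lay)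
    ; finished#pool  = survivors-all r (All.map (survivors-all r) (finished#pool lay))
    ; finished-alive = survivors-alive r finished (finished-alive lay)
    ; pool-alive     = survivors-alive r pool (pool-alive lay)
    }

  finished-grows : ∀ {f f′} j → f + a ≤ b + f′ → f + suc j ≤ f′ + j
  finished-grows {f} {f′} j f+a≤ = begin
    f + suc j ≡⟨ ℕ.+-suc f j ⟩
    suc f + j ≤⟨ ℕ.+-monoˡ-≤ j (ℕ.+-cancelˡ-≤ b _ _ b+suc-f≤) ⟩
    f′ + j    ∎
    where
    open ℕ.≤-Reasoning
    b+suc-f≤ : b + suc f ≤ b + f′
    b+suc-f≤ = begin
      b + suc f ≡⟨ ℕ.+-suc b f ⟩
      suc b + f ≤⟨ ℕ.+-monoˡ-≤ f b<a ⟩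
      a + f     ≡⟨ ℕ.+-comm a f ⟩
      f + a     ≤⟨ f+a≤ ⟩
      b + f′    ∎

  pool-shrinks : ∀ {p p′} j → suc j * (a + b) ≤ a + p → p ≤ b + p′ → j * (a + b) ≤ p′
  pool-shrinks {p} {p′} j bound p≤ = ℕ.+-cancelˡ-≤ (a + b) _ _ (begin
    (a + b) + j * (a + b) ≤⟨ bound ⟩
    a + p                 ≤⟨ ℕ.+-monoʳ-≤ a p≤ ⟩
    a + (b + p′)          ≡⟨ ℕ.+-assoc a b p′ ⟨
    (a + b) + p′          ∎)
    where open ℕ.≤-Reasoning

  round : ∀ {s} j {M Br} (finished : List (Box s)) (pool : List (Box (suc s))) →
          j * (a + b) ≤ length pool → Layout M Br finished pool →
          Forces (Stock s (length finished + j)) M Br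
  round zero finished pool _ lay = done (record
    { boxes  = finished
    ; enough = ℕ.≤-reflexive (ℕ.+-identityʳ (length finished))
    ; apart  = finished-apart lay
    ; alive  = finished-alive lay
    })
  round (suc j) {M} {Br} finished pool enough lay with split-prefix a pool a≤pool
    where
    a≤pool : a ≤ length pool
    a≤pool = ℕ.≤-trans (ℕ.m≤m+n a b) (ℕ.≤-trans (ℕ.m≤m+n (a + b) _) enough)
  ... | P , R , |P| , refl =
    step (heads P) (heads-legal P |P| P-apart (Allₚ.++⁻ˡ P (pool-alive lay))) λ r (|r| , _) →
      round j (survivors r (finished ++ map promote P)) (survivors r R)
            (pool-shrinks j pool-bound (lost r R |r| (pool-apart promoted)))
            (after-breaker r promoted)
      >>= λ st → done (stock-weaken (finished-grows j (finished-lost r |r|)) st)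
    where
    P-apart : AllPairs _#_ P
    P-apart = proj₁ (AllPairs-++⁻ P (pool-apart lay))
    promoted : Layout (heads P ++ M) Br (finished ++ map promote P) R
    promoted = after-maker P R lay
    pool-bound : suc j * (a + b) ≤ a + length R
    pool-bound = subst (_ ≤_) (trans (Listₚ.length-++ P) (cong (_+ length R) |P|)) enough
    length-promoted : length (finished ++ map promote P) ≡ length finished + a
    length-promoted = trans (Listₚ.length-++ finished)
                            (cong (λ k → length finished + k) (trans (Listₚ.length-map promote P) |P|))
    lost : ∀ {t} r (X : List (Box t)) → length r ≡ b → AllPairs _#_ X →
           length X ≤ b + length (survivors r X)
    lost r X |r| X-apart =
      subst (λ k → length X ≤ k + length (survivors r X)) |r| (survivors-length r X X-apart)
    finished-lost : ∀ r → length r ≡ b →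
                    length finished + a ≤ b + length (survivors r (finished ++ map promote P))
    finished-lost r |r| = subst (λ m → m ≤ b + length (survivors r (finished ++ map promote P)))
                                length-promoted (lost r _ |r| (finished-apart promoted))

  stock : ∀ d {s} → d + s ≡ n → ∀ k {M Br} → Forces (Stock s k) M Br
  stock zero          refl    k = done (initial-stock k _ _)
  stock (suc d) {s} d+s≡n k =
    stock d (trans (ℕ.+-suc d s) d+s≡n) (k * (a + b)) >>= λ st →
    round k [] (Stock.boxes st) (Stock.enough st) (record
      { finished-apart = []
      ; pool-apart     = Stock.apart st
      ; finished#pool  = []
      ; finished-alive = []
      ; pool-alive     = Stock.alive st
      })

  complete-box-copy : ∀ {M Br} (x : Box 0) → Alive M Br x → ContainsCopy B A M
  complete-box-copy {M} record { place = φ ; filled = O ; free = Vec.[] ; split = O≡cells } ax =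
    φ , Allₚ.deduplicate⁻ _≟_ (λ { refl c∈ → c∈ }) A
          (Allₚ.map⁻ (subst (All (_∈ M)) (trans (sym (Listₚ.++-identityʳ O)) O≡cells) (filled⊆M ax)))

  stock-copy : ∀ {M Br} → Stock 0 1 M Br → ContainsCopy B A M
  stock-copy record { boxes = x ∷ _ ; alive = ax ∷ _ } = complete-box-copy x ax

  winner : Winner B a b A
  winner = forces⇒wins fresh-cell stock-copy (stock n (ℕ.+-identityʳ n) 1)

shift : {R : Set} → ℤ → ℤ × R → ℤ × R
shift t (x , r) = (t ℤ.+ x , r)

module ShiftInvariantBoard {R : Set} (_≟R_ : DecidableEquality R) (r₀ : R)
                           (_~_ : ℤ × R → ℤ × R → Set)
                           (~-shift : ∀ t {p q} → p ~ q → shift t p ~ shift t q) where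

  shiftBoard : Board
  shiftBoard = record { Cell = ℤ × R ; Adj = _~_ }

  unshift-shift : ∀ t (c : ℤ × R) → shift (- t) (shift t c) ≡ c
  unshift-shift t (x , r) = cong (_, r) (\\-leftDividesʳ t x)

  translation : ℤ → Congruence shiftBoard
  translation t = record
    { to       = shift t
    ; from     = shift (- t)
    ; to-from  = λ { (x , r) → cong (_, r) (\\-leftDividesˡ t x) }
    ; from-to  = unshift-shift t
    ; adj-pres = λ c d → ~-shift t {c} {d}
    ; adj-refl = λ c d tc~td → subst₂ _~_ (unshift-shift t c) (unshift-shift t d)
                                         (~-shift (- t) {shift t c} {shift t d} tc~td)
    }

  bound : List (ℤ × R) → ℕ
  bound S = sum (map (λ c → ∣ proj₁ c ∣) S)

  ∣proj₁∣≤bound : ∀ {c S} → c ∈ S → ∣ proj₁ c ∣ ≤ bound S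
  ∣proj₁∣≤bound {S = _ ∷ _} (here refl) = ℕ.m≤m+n _ _
  ∣proj₁∣≤bound {S = _ ∷ _} (there c∈S) = ℕ.≤-trans (∣proj₁∣≤bound c∈S) (ℕ.m≤n+m _ _)

  shift-meets⇒∣t∣≤bound : ∀ t {c X S} → c ∈ X → shift t c ∈ S → ∣ t ∣ ≤ bound S + bound X
  shift-meets⇒∣t∣≤bound t {x , _} {X} {S} c∈X tc∈S = begin
    ∣ t ∣                  ≡⟨ cong ∣_∣ (//-rightDividesʳ x t) ⟨
    ∣ (t ℤ.+ x) ℤ.- x ∣    ≤⟨ ℤₚ.∣i-j∣≤∣i∣+∣j∣ (t ℤ.+ x) x ⟩
    ∣ t ℤ.+ x ∣ + ∣ x ∣     ≤⟨ ℕ.+-mono-≤ (∣proj₁∣≤bound tc∈S) (∣proj₁∣≤bound c∈X) ⟩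
    bound S + bound X      ∎
    where open ℕ.≤-Reasoning

  displaceable : Displaceable shiftBoard
  displaceable X S = translation t ,
    All.tabulate λ c∈X tc∈S → ℕ.<-irrefl refl (shift-meets⇒∣t∣≤bound t c∈X tc∈S)
    where
    t : ℤ
    t = + suc (bound S + bound X)

  winner : ∀ {a b} → b < a → ∀ A → Winner shiftBoard a b A
  winner = BoxStrategy.winner (≡-dec ℤₚ._≟_ _≟R_) displaceable (+ 0 , r₀)

shift-step : ∀ {x x′ d} t → x′ ≡ x ℤ.+ d → t ℤ.+ x′ ≡ (t ℤ.+ x) ℤ.+ d
shift-step {x} {d = d} t refl = sym (ℤₚ.+-assoc t x d)

Adj2-shift : ∀ offs t {p q : ℤ × ℤ} → Adj2 offs p q → Adj2 offs (shift t p) (shift t q)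
Adj2-shift offs t = Any.map λ { (x≡ , y≡) → shift-step t x≡ , y≡ }

Adj3-shift : ∀ t {p q : ℤ × ℤ × ℤ} → Adj3 p q → Adj3 (shift t p) (shift t q)
Adj3-shift t = Any.map λ { (x≡ , yz≡) → shift-step t x≡ , yz≡ }

TriAdjUD-shift : ∀ t {p q : ℤ × ℤ × Bool} → TriAdjUD p q → TriAdjUD (shift t p) (shift t q)
TriAdjUD-shift t {x , y , true} {x′ , y′ , false} = Adj2-shift triUpDownOffsets t {x , y} {x′ , y′}
TriAdjUD-shift t {_ , _ , true}  {_ , _ , true}  ()
TriAdjUD-shift t {_ , _ , false}                 ()

TriAdj-shift : ∀ t {p q : ℤ × ℤ × Bool} → TriAdj p q → TriAdj (shift t p) (shift t q)
TriAdj-shift t (inj₁ up-down) = inj₁ (TriAdjUD-shift t up-down)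
TriAdj-shift t (inj₂ down-up) = inj₂ (TriAdjUD-shift t down-up)

module Square     = ShiftInvariantBoard ℤₚ._≟_ (+ 0) (Adj2 squareOffsets) (Adj2-shift squareOffsets)
module Hexagonal  = ShiftInvariantBoard ℤₚ._≟_ (+ 0) (Adj2 hexOffsets) (Adj2-shift hexOffsets)
module Cubic      = ShiftInvariantBoard (≡-dec ℤₚ._≟_ ℤₚ._≟_) (+ 0 , + 0) Adj3 Adj3-shift
module Triangular = ShiftInvariantBoard (≡-dec ℤₚ._≟_ Boolₚ._≟_) (+ 0 , false) TriAdj TriAdj-shift

corollary3p4 : (β : BoardName) (a b : ℕ) → 1 ≤ a → b < a →
    (A : List (Cell (board β))) → Connected (board β) A → Winner (board β) a b A
corollary3p4 square     _ _ _ b<a A _ = Square.winner b<a A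
corollary3p4 triangular _ _ _ b<a A _ = Triangular.winner b<a A
corollary3p4 hexagonal  _ _ _ b<a A _ = Hexagonal.winner b<a A
corollary3p4 cubic      _ _ _ b<a A _ = Cubic.winner b<a A
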